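{- Let $S$ denote a simple assignment $x:=e$ and let $\circ$ denote a binary logical connective or a separating connective ($\mathrel{*}$ or $\mathrel{ -\!\!*}$). Then \begin{align*} [S]\mathbf{false} &\equiv \mathbf{false} \tag{E1}\\ [S](p\circ q) &\equiv [S]p\circ [S]q \tag{E2}\\ [S](\forall y\, p) &\equiv \forall y\,([S]p) \tag{E3} \end{align*} where in (E3) it is assumed that $y$ does not appear in $S$, neither in the left-hand side nor in the right-hand side of the assignment.
   Context: Setting (Dynamic Separation Logic, DSL). Heaps $h$ are finitely-based partial functions $\mathbb{Z}\rightharpoonup\mathbb{Z}$, stores $s$ are total functions from a countably infinite set of integer variables to $\mathbb{Z}$. Arithmetic expressions $e$ and Boolean expressions $b$ do not refer to the heap; $s(e)$, $s(b)$ denote their values. $h=h_1\uplus h_2$ means $h$ is the disjoint union of $h_1,h_2$. Assertions: $p,q ::= b \mid (e\hookrightarrow e') \mid (p\to q)\mid (\forall x\, p)\mid (p\mathrel{*}q)\mid (p\mathrel{ -\!\!*}q)\mid [S]p$, where $h,s\models (e\hookrightarrow e')$ iff $s(e)\in\mathrm{dom}(h)$ and $h(s(e))=s(e')$; $h,s\models p\mathrel{*}q$ iff $h=h_1\uplus h_2$ with $h_1,s\models p$ and $h_2,s\models q$; $h,s\models p\mathrel{ -\!\!*}q$ iff for all $h'$ disjoint from $h$ with $h',s\models p$ we have $h\uplus h',s\models q$; $h,s\models [S]p$ iff executing $S$ from $(h,s)$ does not fail and every resulting state $(h',s')$ satisfies $p$. The simple assignment $x:=e$ maps $(h,s)$ to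 $(h,s[x:=s(e)])$. $p\equiv q$ means $p$ and $q$ hold in exactly the same heap–store pairs. -}

module Defs where

open import Data.Nat using (ℕ)
open import Data.Integer as ℤ using (ℤ)
open import Data.Bool using (Bool; true; false; if_then_else_; not; _∧_)
open import Data.Maybe using (Maybe; just; nothing; _<∣>_)
open import Data.List using (List; _∷_; _++_)
open import Data.List.Membership.Propositional using (_∈_; _∉_)
open import Data.Product using (Σ; ∃; _×_; _,_)
open import Data.Sum using (_⊎_)
open import Data.Empty using (⊥)
open import Relation.Nullary using (¬_; does)
open import Relation.Binary.PropositionalEquality using (_≡_; _≢_)
import Data.Nat as ℕ

Var : Set
Var = ℕ

Store : Set
Store = Var → ℤ

_[_↦_] : Store → Var → ℤ → Store
(s [ x ↦ v ]) y = if does (y ℕ.≟ x) then v else s y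

record Heap : Set where
  constructor mkHeap
  field
    fun    : ℤ → Maybe ℤ
    finite : ∃ λ (L : List ℤ) → ∀ n → n ∉ L → fun n ≡ nothing
open Heap public

_∈dom_ : ℤ → Heap → Set
n ∈dom h = ∃ λ v → fun h n ≡ just v

_[_≔_] : Heap → ℤ → ℤ → Heap
fun (h [ n ≔ v ]) m = if does (m ℤ.≟ n) then just v else fun h m
finite (h [ n ≔ v ]) with finite h
... | L , p = n ∷ L , λ m m∉ → helper m m∉
  where
  open import Data.List.Relation.Unary.Any using (here; there)
  helper : ∀ m → m ∉ n ∷ L → (if does (m ℤ.≟ n) then just v else fun h m) ≡ nothing
  helper m m∉ with m ℤ.≟ n
  ... | Relation.Nullary.yes eq = Data.Empty.⊥-elim (m∉ (here eq))
    where import Data.Empty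
  ... | Relation.Nullary.no _ = p m (λ m∈ → m∉ (there m∈))
    where import Relation.Nullary

_∖_ : Heap → ℤ → Heap
fun (h ∖ n) m = if does (m ℤ.≟ n) then nothing else fun h m
finite (h ∖ n) with finite h
... | L , p = L , λ m m∉ → helper m m∉
  where
  helper : ∀ m → m ∉ L → (if does (m ℤ.≟ n) then nothing else fun h m) ≡ nothing
  helper m m∉ with does (m ℤ.≟ n)
  ... | true = Relation.Binary.PropositionalEquality.refl
    where import Relation.Binary.PropositionalEquality
  ... | false = p m m∉

Disjoint : Heap → Heap → Set
Disjoint h₁ h₂ = ∀ n → fun h₁ n ≡ nothing ⊎ fun h₂ n ≡ nothing

-- union of heaps (meaningful as disjoint union when Disjoint h₁ h₂)
_∪_ : Heap → Heap → Heap
fun (h₁ ∪ h₂) n = fun h₁ n <∣> fun h₂ n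
finite (h₁ ∪ h₂) with finite h₁ | finite h₂
... | L₁ , p₁ | L₂ , p₂ = L₁ ++ L₂ , λ n n∉ → helper n n∉
  where
  open import Data.List.Membership.Propositional.Properties using (∈-++⁺ˡ; ∈-++⁺ʳ)
  open import Relation.Binary.PropositionalEquality using (refl)
  helper : ∀ n → n ∉ L₁ ++ L₂ → (fun h₁ n <∣> fun h₂ n) ≡ nothing
  helper n n∉ with fun h₁ n | p₁ n (λ i → n∉ (∈-++⁺ˡ i))
  ... | nothing | refl = p₂ n (λ i → n∉ (∈-++⁺ʳ L₁ i))

_≐_⊎_ : Heap → Heap → Heap → Set
h ≐ h₁ ⊎ h₂ = Disjoint h₁ h₂ × (∀ n → fun h n ≡ fun (h₁ ∪ h₂) n)

data Exp : Set where
  num  : ℤ → Exp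
  var  : Var → Exp
  _⊕_  : Exp → Exp → Exp
  _⊖_  : Exp → Exp → Exp
  _⊗_  : Exp → Exp → Exp

⟦_⟧ₑ : Exp → Store → ℤ
⟦ num n ⟧ₑ s = n
⟦ var x ⟧ₑ s = s x
⟦ e ⊕ e' ⟧ₑ s = ⟦ e ⟧ₑ s ℤ.+ ⟦ e' ⟧ₑ s
⟦ e ⊖ e' ⟧ₑ s = ⟦ e ⟧ₑ s ℤ.- ⟦ e' ⟧ₑ s
⟦ e ⊗ e' ⟧ₑ s = ⟦ e ⟧ₑ s ℤ.* ⟦ e' ⟧ₑ s

_occursIn_ : Var → Exp → Set
y occursIn num n = ⊥
y occursIn var x = y ≡ x
y occursIn (e ⊕ e') = y occursIn e ⊎ y occursIn e'
y occursIn (e ⊖ e') = y occursIn e ⊎ y occursIn e'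
y occursIn (e ⊗ e') = y occursIn e ⊎ y occursIn e'

data BExp : Set where
  tt ff : BExp
  _≐ᵇ_ : Exp → Exp → BExp
  _≤ᵇ_ : Exp → Exp → BExp
  ¬ᵇ_  : BExp → BExp
  _∧ᵇ_ : BExp → BExp → BExp

⟦_⟧ᵦ : BExp → Store → Bool
⟦ tt ⟧ᵦ s = true
⟦ ff ⟧ᵦ s = false
⟦ e ≐ᵇ e' ⟧ᵦ s = does (⟦ e ⟧ₑ s ℤ.≟ ⟦ e' ⟧ₑ s)
⟦ e ≤ᵇ e' ⟧ᵦ s = does (⟦ e ⟧ₑ s ℤ.≤? ⟦ e' ⟧ₑ s)
⟦ ¬ᵇ b ⟧ᵦ s = not (⟦ b ⟧ᵦ s)
⟦ b ∧ᵇ b' ⟧ᵦ s = ⟦ b ⟧ᵦ s ∧ ⟦ b' ⟧ᵦ s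

data Prog : Set where
  _≔_        : Var → Exp → Prog
  _≔[_]      : Var → Exp → Prog
  [_]≔_      : Exp → Exp → Prog
  _≔cons_    : Var → Exp → Prog
  dispose    : Exp → Prog
  _⨾_        : Prog → Prog → Prog
  ifᵖ_then_else_ : BExp → Prog → Prog → Prog
  while_loop_  : BExp → Prog → Prog

State : Set
State = Heap × Store

data Outcome : Set where
  fail : Outcome
  ok   : State → Outcome

data ⟨_,_⟩⇓_ : Prog → State → Outcome → Set where
  assign   : ∀ {x e h s} → ⟨ x ≔ e , (h , s) ⟩⇓ ok (h , s [ x ↦ ⟦ e ⟧ₑ s ])
  lookup   : ∀ {x e h s v} → fun h (⟦ e ⟧ₑ s) ≡ just v →
             ⟨ x ≔[ e ] , (h , s) ⟩⇓ ok (h , s [ x ↦ v ])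
  lookupF  : ∀ {x e h s} → fun h (⟦ e ⟧ₑ s) ≡ nothing →
             ⟨ x ≔[ e ] , (h , s) ⟩⇓ fail
  mutate   : ∀ {e e' h s} → ⟦ e ⟧ₑ s ∈dom h →
             ⟨ [ e ]≔ e' , (h , s) ⟩⇓ ok (h [ ⟦ e ⟧ₑ s ≔ ⟦ e' ⟧ₑ s ] , s)
  mutateF  : ∀ {e e' h s} → fun h (⟦ e ⟧ₑ s) ≡ nothing →
             ⟨ [ e ]≔ e' , (h , s) ⟩⇓ fail
  cons     : ∀ {x e h s n} → fun h n ≡ nothing →
             ⟨ x ≔cons e , (h , s) ⟩⇓ ok (h [ n ≔ ⟦ e ⟧ₑ s ] , s [ x ↦ n ])
  disp     : ∀ {e h s} → ⟦ e ⟧ₑ s ∈dom h →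
             ⟨ dispose e , (h , s) ⟩⇓ ok (h ∖ ⟦ e ⟧ₑ s , s)
  dispF    : ∀ {e h s} → fun h (⟦ e ⟧ₑ s) ≡ nothing →
             ⟨ dispose e , (h , s) ⟩⇓ fail
  seq      : ∀ {S₁ S₂ σ σ' o} → ⟨ S₁ , σ ⟩⇓ ok σ' → ⟨ S₂ , σ' ⟩⇓ o →
             ⟨ S₁ ⨾ S₂ , σ ⟩⇓ o
  seqF     : ∀ {S₁ S₂ σ} → ⟨ S₁ , σ ⟩⇓ fail → ⟨ S₁ ⨾ S₂ , σ ⟩⇓ fail
  ifT      : ∀ {b S₁ S₂ h s o} → ⟦ b ⟧ᵦ s ≡ true → ⟨ S₁ , (h , s) ⟩⇓ o →
             ⟨ ifᵖ b then S₁ else S₂ , (h , s) ⟩⇓ o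
  ifF      : ∀ {b S₁ S₂ h s o} → ⟦ b ⟧ᵦ s ≡ false → ⟨ S₂ , (h , s) ⟩⇓ o →
             ⟨ ifᵖ b then S₁ else S₂ , (h , s) ⟩⇓ o
  whileF   : ∀ {b S h s} → ⟦ b ⟧ᵦ s ≡ false →
             ⟨ while b loop S , (h , s) ⟩⇓ ok (h , s)
  whileT   : ∀ {b S h s σ' o} → ⟦ b ⟧ᵦ s ≡ true → ⟨ S , (h , s) ⟩⇓ ok σ' →
             ⟨ while b loop S , σ' ⟩⇓ o → ⟨ while b loop S , (h , s) ⟩⇓ o
  whileTF  : ∀ {b S h s} → ⟦ b ⟧ᵦ s ≡ true → ⟨ S , (h , s) ⟩⇓ fail →
             ⟨ while b loop S , (h , s) ⟩⇓ fail

data Assn : Set where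
  bool  : BExp → Assn
  _↪_   : Exp → Exp → Assn
  _⇒_   : Assn → Assn → Assn
  all   : Var → Assn → Assn
  _✱_   : Assn → Assn → Assn
  _−✱_  : Assn → Assn → Assn
  ⟦_⟧_  : Prog → Assn → Assn

false𝔸 : Assn
false𝔸 = bool ff

¬𝔸 : Assn → Assn
¬𝔸 p = p ⇒ false𝔸

_∨𝔸_ : Assn → Assn → Assn
p ∨𝔸 q = ¬𝔸 p ⇒ q

_∧𝔸_ : Assn → Assn → Assn
p ∧𝔸 q = ¬𝔸 (p ⇒ ¬𝔸 q)

_⇔𝔸_ : Assn → Assn → Assn
p ⇔𝔸 q = (p ⇒ q) ∧𝔸 (q ⇒ p)

data Conn : Set where
  IMP AND OR IFF SEP WAND : Conn

apply : Conn → Assn → Assn → Assn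
apply IMP  p q = p ⇒ q
apply AND  p q = p ∧𝔸 q
apply OR   p q = p ∨𝔸 q
apply IFF  p q = p ⇔𝔸 q
apply SEP  p q = p ✱ q
apply WAND p q = p −✱ q

_,_⊨_ : Heap → Store → Assn → Set
h , s ⊨ bool b = ⟦ b ⟧ᵦ s ≡ true
h , s ⊨ (e ↪ e') = fun h (⟦ e ⟧ₑ s) ≡ just (⟦ e' ⟧ₑ s)
h , s ⊨ (p ⇒ q) = h , s ⊨ p → h , s ⊨ q
h , s ⊨ all x p = ∀ (v : ℤ) → h , s [ x ↦ v ] ⊨ p
h , s ⊨ (p ✱ q) = ∃ λ h₁ → ∃ λ h₂ → h ≐ h₁ ⊎ h₂ × h₁ , s ⊨ p × h₂ , s ⊨ q
h , s ⊨ (p −✱ q) = ∀ h' → Disjoint h h' → h' , s ⊨ p → (h ∪ h') , s ⊨ q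
h , s ⊨ (⟦ S ⟧ p) = ¬ ⟨ S , (h , s) ⟩⇓ fail ×
                    (∀ h' s' → ⟨ S , (h , s) ⟩⇓ ok (h' , s') → h' , s' ⊨ p)

_≣_ : Assn → Assn → Set
p ≣ q = ∀ h s → (h , s ⊨ p → h , s ⊨ q) × (h , s ⊨ q → h , s ⊨ p)

-- The assignment x := e never fails and has the single outcome (h , s [ x ↦ ⟦ e ⟧ₑ s ]),
-- so [x := e] p holds at (h , s) exactly when p holds at the updated store.  Every
-- connective is interpreted at a fixed store (the separating ones quantify only over
-- heaps), hence commutes with this store update.  For ∀ y, the updates of x and of y
-- commute because y ≢ x, and updating y leaves ⟦ e ⟧ₑ unchanged because y does not occur
-- in e.  Stores are functions, so the two orders of update agree only pointwise; what
-- makes this enough is that satisfaction, including that of [S] p through the big-step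
-- semantics, is invariant under pointwise equality of stores.
module Submission where

open import Defs
open import Data.Product using (_×_)
open import Relation.Nullary using (¬_)
open import Relation.Binary.PropositionalEquality using (_≢_)

open import Data.Bool using (true; false; if_then_else_; not; _∧_)
open import Data.Empty using (⊥-elim)
open import Data.Maybe using (just)
open import Data.Nat using (_≟_)
open import Data.Product using (∃; _,_)
open import Data.Sum using (inj₁; inj₂)
open import Data.Integer as ℤ using (ℤ)
open import Function using (_∘_)
open import Function.Bundles using (_⇔_; mk⇔; Equivalence)
open import Function.Related.TypeIsomorphisms using (→-cong-⇔)
open import Function.Construct.Identity using (⇔-id)
open import Function.Construct.Symmetry using (⇔-sym)
open import Function.Construct.Composition using (_⇔-∘_)
open import Relation.Nullary using (does; yes; no)
open import Relation.Nullary.Decidable using (dec-true; dec-false)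
open import Relation.Binary.PropositionalEquality
  using (_≡_; _≗_; refl; sym; trans; cong; cong₂; subst; subst₂)

open Equivalence using (to; from)

≗-sym : {s s' : Store} → s ≗ s' → s' ≗ s
≗-sym s≗s' y = sym (s≗s' y)

[↦]-cong : ∀ {s s'} x v → s ≗ s' → s [ x ↦ v ] ≗ s' [ x ↦ v ]
[↦]-cong x v s≗s' y with does (y ≟ x)
... | true  = refl
... | false = s≗s' y

[↦]-same : ∀ s x v → (s [ x ↦ v ]) x ≡ v
[↦]-same s x v = cong (if_then v else s x) (dec-true (x ≟ x) refl)

[↦]-other : ∀ s {x y} v → y ≢ x → (s [ x ↦ v ]) y ≡ s y
[↦]-other s {x} {y} v y≢x = cong (if_then v else s y) (dec-false (y ≟ x) y≢x)

[↦]-comm : ∀ s {x y} u v → y ≢ x → (s [ x ↦ u ]) [ y ↦ v ] ≗ (s [ y ↦ v ]) [ x ↦ u ]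
[↦]-comm s {x} {y} u v y≢x z with z ≟ y | z ≟ x
... | yes refl | yes refl = ⊥-elim (y≢x refl)
... | yes refl | no z≢x   =
  trans ([↦]-same (s [ x ↦ u ]) z v)
        (sym (trans ([↦]-other (s [ z ↦ v ]) u z≢x) ([↦]-same s z v)))
... | no z≢y   | yes refl =
  trans ([↦]-other (s [ z ↦ u ]) v z≢y)
        (trans ([↦]-same s z u) (sym ([↦]-same (s [ y ↦ v ]) z u)))
... | no z≢y   | no z≢x   =
  trans ([↦]-other (s [ x ↦ u ]) v z≢y)
        (trans ([↦]-other s u z≢x)
               (sym (trans ([↦]-other (s [ y ↦ v ]) u z≢x) ([↦]-other s v z≢y))))

⟦⟧ₑ-cong : ∀ e {s s'} → s ≗ s' → ⟦ e ⟧ₑ s ≡ ⟦ e ⟧ₑ s'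
⟦⟧ₑ-cong (num n)  s≗s' = refl
⟦⟧ₑ-cong (var x)  s≗s' = s≗s' x
⟦⟧ₑ-cong (e ⊕ e') s≗s' = cong₂ ℤ._+_ (⟦⟧ₑ-cong e s≗s') (⟦⟧ₑ-cong e' s≗s')
⟦⟧ₑ-cong (e ⊖ e') s≗s' = cong₂ ℤ._-_ (⟦⟧ₑ-cong e s≗s') (⟦⟧ₑ-cong e' s≗s')
⟦⟧ₑ-cong (e ⊗ e') s≗s' = cong₂ ℤ._*_ (⟦⟧ₑ-cong e s≗s') (⟦⟧ₑ-cong e' s≗s')

⟦⟧ₑ-[↦]-fresh : ∀ e {y} s v → ¬ (y occursIn e) → ⟦ e ⟧ₑ (s [ y ↦ v ]) ≡ ⟦ e ⟧ₑ s
⟦⟧ₑ-[↦]-fresh (num n) s v y∉e = refl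
⟦⟧ₑ-[↦]-fresh (var z) s v y∉e = [↦]-other s v (y∉e ∘ sym)
⟦⟧ₑ-[↦]-fresh (e ⊕ e') s v y∉e =
  cong₂ ℤ._+_ (⟦⟧ₑ-[↦]-fresh e s v (y∉e ∘ inj₁)) (⟦⟧ₑ-[↦]-fresh e' s v (y∉e ∘ inj₂))
⟦⟧ₑ-[↦]-fresh (e ⊖ e') s v y∉e =
  cong₂ ℤ._-_ (⟦⟧ₑ-[↦]-fresh e s v (y∉e ∘ inj₁)) (⟦⟧ₑ-[↦]-fresh e' s v (y∉e ∘ inj₂))
⟦⟧ₑ-[↦]-fresh (e ⊗ e') s v y∉e =
  cong₂ ℤ._*_ (⟦⟧ₑ-[↦]-fresh e s v (y∉e ∘ inj₁)) (⟦⟧ₑ-[↦]-fresh e' s v (y∉e ∘ inj₂))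

[↦]-comm-≔ : ∀ s {x y} e v → y ≢ x → ¬ (y occursIn e) →
             (s [ x ↦ ⟦ e ⟧ₑ s ]) [ y ↦ v ] ≗ (s [ y ↦ v ]) [ x ↦ ⟦ e ⟧ₑ (s [ y ↦ v ]) ]
[↦]-comm-≔ s {x} e v y≢x y∉e z =
  trans ([↦]-comm s (⟦ e ⟧ₑ s) v y≢x z)
        (cong (λ u → ((s [ _ ↦ v ]) [ x ↦ u ]) z) (sym (⟦⟧ₑ-[↦]-fresh e s v y∉e)))

⟦⟧ᵦ-cong : ∀ b {s s'} → s ≗ s' → ⟦ b ⟧ᵦ s ≡ ⟦ b ⟧ᵦ s'
⟦⟧ᵦ-cong tt        s≗s' = refl
⟦⟧ᵦ-cong ff        s≗s' = refl
⟦⟧ᵦ-cong (e ≐ᵇ e') s≗s' = cong₂ (λ m n → does (m ℤ.≟ n)) (⟦⟧ₑ-cong e s≗s') (⟦⟧ₑ-cong e' s≗s')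
⟦⟧ᵦ-cong (e ≤ᵇ e') s≗s' = cong₂ (λ m n → does (m ℤ.≤? n)) (⟦⟧ₑ-cong e s≗s') (⟦⟧ₑ-cong e' s≗s')
⟦⟧ᵦ-cong (¬ᵇ b)    s≗s' = cong not (⟦⟧ᵦ-cong b s≗s')
⟦⟧ᵦ-cong (b ∧ᵇ b') s≗s' = cong₂ _∧_ (⟦⟧ᵦ-cong b s≗s') (⟦⟧ᵦ-cong b' s≗s')

module _ {s s' : Store} (s≗s' : s ≗ s') where

  guard-cong : ∀ b {t} → ⟦ b ⟧ᵦ s ≡ t → ⟦ b ⟧ᵦ s' ≡ t
  guard-cong b = trans (sym (⟦⟧ᵦ-cong b s≗s'))

  heap-at-cong : ∀ h e {m} → fun h (⟦ e ⟧ₑ s) ≡ m → fun h (⟦ e ⟧ₑ s') ≡ m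
  heap-at-cong h e = subst (λ n → fun h n ≡ _) (⟦⟧ₑ-cong e s≗s')

data _≈ₒ_ : Outcome → Outcome → Set where
  fail : fail ≈ₒ fail
  ok   : ∀ {h s s'} → s ≗ s' → ok (h , s) ≈ₒ ok (h , s')

⇓-cong : ∀ {S h s s' o} → s ≗ s' → ⟨ S , (h , s) ⟩⇓ o →
         ∃ λ o' → ⟨ S , (h , s') ⟩⇓ o' × o ≈ₒ o'
⇓-cong {s = s} {s'} s≗s' (assign {x} {e}) =
  _ , assign , ok λ y → trans ([↦]-cong x _ s≗s' y)
                              (cong (λ v → (s' [ x ↦ v ]) y) (⟦⟧ₑ-cong e s≗s'))
⇓-cong s≗s' (lookup {x} {e} {h} {v = v} h[e]≡v) =
  _ , lookup (heap-at-cong s≗s' h e h[e]≡v) , ok ([↦]-cong x v s≗s')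
⇓-cong s≗s' (lookupF {e = e} {h} h[e]≡∅) = _ , lookupF (heap-at-cong s≗s' h e h[e]≡∅) , fail
⇓-cong {s' = s'} s≗s' (mutate {e} {e'} {h} (v , h[e]≡v)) =
  _ , subst₂ (λ n m → ⟨ [ e ]≔ e' , (h , s') ⟩⇓ ok (h [ n ≔ m ] , s'))
             (sym (⟦⟧ₑ-cong e s≗s')) (sym (⟦⟧ₑ-cong e' s≗s'))
             (mutate (v , heap-at-cong s≗s' h e h[e]≡v))
    , ok s≗s'
⇓-cong s≗s' (mutateF {e} {h = h} h[e]≡∅) = _ , mutateF (heap-at-cong s≗s' h e h[e]≡∅) , fail
⇓-cong {s' = s'} s≗s' (cons {x} {e} {h} {n = n} h[n]≡∅) =
  _ , subst (λ m → ⟨ x ≔cons e , (h , s') ⟩⇓ ok (h [ n ≔ m ] , s' [ x ↦ n ]))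
            (sym (⟦⟧ₑ-cong e s≗s')) (cons h[n]≡∅)
    , ok ([↦]-cong x n s≗s')
⇓-cong {s' = s'} s≗s' (disp {e} {h} (v , h[e]≡v)) =
  _ , subst (λ n → ⟨ dispose e , (h , s') ⟩⇓ ok (h ∖ n , s'))
            (sym (⟦⟧ₑ-cong e s≗s')) (disp (v , heap-at-cong s≗s' h e h[e]≡v))
    , ok s≗s'
⇓-cong s≗s' (dispF {e} {h} h[e]≡∅) = _ , dispF (heap-at-cong s≗s' h e h[e]≡∅) , fail
⇓-cong s≗s' (seq ⇓₁ ⇓₂) with ⇓-cong s≗s' ⇓₁
... | _ , ⇓₁' , ok s₁≗s₁' with ⇓-cong s₁≗s₁' ⇓₂
...   | _ , ⇓₂' , o≈o' = _ , seq ⇓₁' ⇓₂' , o≈o'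
⇓-cong s≗s' (seqF ⇓₁) with ⇓-cong s≗s' ⇓₁
... | _ , ⇓₁' , fail = _ , seqF ⇓₁' , fail
⇓-cong s≗s' (ifT {b} b-true ⇓₁) with ⇓-cong s≗s' ⇓₁
... | _ , ⇓₁' , o≈o' = _ , ifT (guard-cong s≗s' b b-true) ⇓₁' , o≈o'
⇓-cong s≗s' (ifF {b} b-false ⇓₂) with ⇓-cong s≗s' ⇓₂
... | _ , ⇓₂' , o≈o' = _ , ifF (guard-cong s≗s' b b-false) ⇓₂' , o≈o'
⇓-cong s≗s' (whileF {b} b-false) = _ , whileF (guard-cong s≗s' b b-false) , ok s≗s'
⇓-cong s≗s' (whileT {b} b-true ⇓₁ ⇓₂) with ⇓-cong s≗s' ⇓₁
... | _ , ⇓₁' , ok s₁≗s₁' with ⇓-cong s₁≗s₁' ⇓₂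
...   | _ , ⇓₂' , o≈o' = _ , whileT (guard-cong s≗s' b b-true) ⇓₁' ⇓₂' , o≈o'
⇓-cong s≗s' (whileTF {b} b-true ⇓₁) with ⇓-cong s≗s' ⇓₁
... | _ , ⇓₁' , fail = _ , whileTF (guard-cong s≗s' b b-true) ⇓₁' , fail

⊨-transport : ∀ p {h s s'} → s ≗ s' → h , s ⊨ p → h , s' ⊨ p
⊨-transport (bool b)  s≗s' ⊨b = guard-cong s≗s' b ⊨b
⊨-transport (e ↪ e') {h} s≗s' ⊨e↪e' =
  heap-at-cong s≗s' h e (trans ⊨e↪e' (cong just (⟦⟧ₑ-cong e' s≗s')))
⊨-transport (p ⇒ q)   s≗s' ⊨p⇒q ⊨p = ⊨-transport q s≗s' (⊨p⇒q (⊨-transport p (≗-sym s≗s') ⊨p))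
⊨-transport (all x p) s≗s' ⊨∀p v = ⊨-transport p ([↦]-cong x v s≗s') (⊨∀p v)
⊨-transport (p ✱ q)   s≗s' (h₁ , h₂ , h≐h₁⊎h₂ , ⊨p , ⊨q) =
  h₁ , h₂ , h≐h₁⊎h₂ , ⊨-transport p s≗s' ⊨p , ⊨-transport q s≗s' ⊨q
⊨-transport (p −✱ q)  s≗s' ⊨p−✱q h' h#h' ⊨p =
  ⊨-transport q s≗s' (⊨p−✱q h' h#h' (⊨-transport p (≗-sym s≗s') ⊨p))
⊨-transport (⟦ S ⟧ p) s≗s' (no-fail , ⊨post) = no-fail' , ⊨post'
  where
  no-fail' : ¬ ⟨ S , (_ , _) ⟩⇓ fail
  no-fail' ⇓fail with ⇓-cong (≗-sym s≗s') ⇓fail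
  ... | _ , ⇓fail' , fail = no-fail ⇓fail'
  ⊨post' : ∀ h' t' → ⟨ S , (_ , _) ⟩⇓ ok (h' , t') → h' , t' ⊨ p
  ⊨post' h' t' ⇓t' with ⇓-cong (≗-sym s≗s') ⇓t'
  ... | _ , ⇓t , ok t'≗t = ⊨-transport p (≗-sym t'≗t) (⊨post h' _ ⇓t)

-- A record rather than a function type so that p and q can be inferred from a proof.
record _⟨_⟩≋⟨_⟩_ (p : Assn) (s s' : Store) (q : Assn) : Set where
  constructor mk≋
  field at : ∀ h → (h , s ⊨ p) ⇔ (h , s' ⊨ q)
open _⟨_⟩≋⟨_⟩_

≣-intro : ∀ {p q} → (∀ s → p ⟨ s ⟩≋⟨ s ⟩ q) → p ≣ q
≣-intro p≋q h s = to (at (p≋q s) h) , from (at (p≋q s) h)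

module _ {s s' : Store} where

  ≋-sym : ∀ {p q} → p ⟨ s ⟩≋⟨ s' ⟩ q → q ⟨ s' ⟩≋⟨ s ⟩ p
  ≋-sym p≋q = mk≋ λ h → ⇔-sym (at p≋q h)

  ≋-trans : ∀ {s'' p q r} → p ⟨ s ⟩≋⟨ s' ⟩ q → q ⟨ s' ⟩≋⟨ s'' ⟩ r → p ⟨ s ⟩≋⟨ s'' ⟩ r
  ≋-trans p≋q q≋r = mk≋ λ h → at q≋r h ⇔-∘ at p≋q h

  ⊨-cong : ∀ p → s ≗ s' → p ⟨ s ⟩≋⟨ s' ⟩ p
  ⊨-cong p s≗s' = mk≋ λ h → mk⇔ (⊨-transport p s≗s') (⊨-transport p (≗-sym s≗s'))

  false𝔸-cong : false𝔸 ⟨ s ⟩≋⟨ s' ⟩ false𝔸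
  false𝔸-cong = mk≋ λ h → ⇔-id _

  module _ {p p' q q' : Assn} (p≋p' : p ⟨ s ⟩≋⟨ s' ⟩ p') (q≋q' : q ⟨ s ⟩≋⟨ s' ⟩ q') where

    ⇒-cong : (p ⇒ q) ⟨ s ⟩≋⟨ s' ⟩ (p' ⇒ q')
    ⇒-cong = mk≋ λ h → →-cong-⇔ (at p≋p' h) (at q≋q' h)

    ✱-cong : (p ✱ q) ⟨ s ⟩≋⟨ s' ⟩ (p' ✱ q')
    ✱-cong = mk≋ λ h → mk⇔
      (λ (h₁ , h₂ , split , ⊨p , ⊨q) → h₁ , h₂ , split , to (at p≋p' h₁) ⊨p , to (at q≋q' h₂) ⊨q)
      (λ (h₁ , h₂ , split , ⊨p , ⊨q) → h₁ , h₂ , split , from (at p≋p' h₁) ⊨p , from (at q≋q' h₂) ⊨q)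

    −✱-cong : (p −✱ q) ⟨ s ⟩≋⟨ s' ⟩ (p' −✱ q')
    −✱-cong = mk≋ λ h → mk⇔
      (λ ⊨p−✱q h' h#h' ⊨p → to (at q≋q' (h ∪ h')) (⊨p−✱q h' h#h' (from (at p≋p' h') ⊨p)))
      (λ ⊨p−✱q h' h#h' ⊨p → from (at q≋q' (h ∪ h')) (⊨p−✱q h' h#h' (to (at p≋p' h') ⊨p)))

  ¬𝔸-cong : ∀ {p p'} → p ⟨ s ⟩≋⟨ s' ⟩ p' → ¬𝔸 p ⟨ s ⟩≋⟨ s' ⟩ ¬𝔸 p'
  ¬𝔸-cong p≋p' = ⇒-cong p≋p' false𝔸-cong

  ∧𝔸-cong : ∀ {p p' q q'} → p ⟨ s ⟩≋⟨ s' ⟩ p' → q ⟨ s ⟩≋⟨ s' ⟩ q' →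
            (p ∧𝔸 q) ⟨ s ⟩≋⟨ s' ⟩ (p' ∧𝔸 q')
  ∧𝔸-cong p≋p' q≋q' = ¬𝔸-cong (⇒-cong p≋p' (¬𝔸-cong q≋q'))

  apply-cong : ∀ c {p p' q q'} → p ⟨ s ⟩≋⟨ s' ⟩ p' → q ⟨ s ⟩≋⟨ s' ⟩ q' →
               apply c p q ⟨ s ⟩≋⟨ s' ⟩ apply c p' q'
  apply-cong IMP  p≋p' q≋q' = ⇒-cong p≋p' q≋q'
  apply-cong AND  p≋p' q≋q' = ∧𝔸-cong p≋p' q≋q'
  apply-cong OR   p≋p' q≋q' = ⇒-cong (¬𝔸-cong p≋p') q≋q'
  apply-cong IFF  p≋p' q≋q' = ∧𝔸-cong (⇒-cong p≋p' q≋q') (⇒-cong q≋q' p≋p')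
  apply-cong SEP  p≋p' q≋q' = ✱-cong p≋p' q≋q'
  apply-cong WAND p≋p' q≋q' = −✱-cong p≋p' q≋q'

all-cong : ∀ {s s'} y {p q} → (∀ v → p ⟨ s [ y ↦ v ] ⟩≋⟨ s' [ y ↦ v ] ⟩ q) →
           all y p ⟨ s ⟩≋⟨ s' ⟩ all y q
all-cong y p≋q = mk≋ λ h →
  mk⇔ (λ ⊨∀p v → to (at (p≋q v) h) (⊨∀p v)) (λ ⊨∀q v → from (at (p≋q v) h) (⊨∀q v))

≔-wp : ∀ x e p s → (⟦ x ≔ e ⟧ p) ⟨ s ⟩≋⟨ s [ x ↦ ⟦ e ⟧ₑ s ] ⟩ p
≔-wp x e p s = mk≋ λ h →
  mk⇔ (λ (_ , ⊨post) → ⊨post h _ assign) (λ ⊨p → (λ ()) , λ { _ _ assign → ⊨p })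

lemma3p1 : ∀ (x : Var) (e : Exp) →
    ((⟦ x ≔ e ⟧ false𝔸) ≣ false𝔸)
    × (∀ (c : Conn) (p q : Assn) →
         (⟦ x ≔ e ⟧ apply c p q) ≣ apply c (⟦ x ≔ e ⟧ p) (⟦ x ≔ e ⟧ q))
    × (∀ (y : Var) (p : Assn) → y ≢ x → ¬ (y occursIn e) →
         (⟦ x ≔ e ⟧ all y p) ≣ all y (⟦ x ≔ e ⟧ p))
lemma3p1 x e =
    ≣-intro (λ s → ≋-trans (≔-wp x e false𝔸 s) false𝔸-cong)
  , (λ c p q → ≣-intro λ s →
       ≋-trans (≔-wp x e (apply c p q) s)
               (apply-cong c (≋-sym (≔-wp x e p s)) (≋-sym (≔-wp x e q s))))
  , λ y p y≢x y∉e → ≣-intro λ s →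
       ≋-trans (≔-wp x e (all y p) s) (all-cong y λ v →
         ≋-trans (⊨-cong p ([↦]-comm-≔ s e v y≢x y∉e)) (≋-sym (≔-wp x e p (s [ y ↦ v ]))))
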